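{- Let $G=G_1+\dots+G_k$ be a factorisation of a Left dead end $G$ into atoms $G_1,\dots,G_k$ such that, for every $1\leq i\leq k$, the game $G_i+G_{i+1}+\dots+G_k$ has a good option of the form $G_i'+G_{i+1}+\dots+G_k$ where $G_i'$ is an option of $G_i$ that is prime-factorisable. Then $G$ is uniquely factorisable.
   Context: All games are short partizan combinatorial game forms; $G+H$ is the disjunctive sum. Play is misère (a player unable to move wins). Misère outcome classes are ordered $\mathscr L>\mathscr P>\mathscr R$ and $\mathscr L>\mathscr N>\mathscr R$; $G\geq H$ means that for every game $X$ the misère outcome of $G+X$ is $\geq$ that of $H+X$, $G=H$ means $G\ge H$ and $H\ge G$, and $G>H$ means $G\ge H$ and $G\ne H$. A Left dead end is a game no subposition of which (including itself) has a Left option; its options are its Right options; the options of a sum $X+Y$ of Left dead ends are the games $X'+Y$ and $X+Y'$. An option $G'$ of $G$ is good if there is no option $G''$ of $G$ with $G'>G''$. The Left dead ends up to equality form a commutative monoid $\mathcal L$ under $+$ with identity $0=\{\cdot\mid\cdot\}$. An atom is a Left dead end $A\neq0$ such that $A=X+Y$ with Left dead ends $X,Y$ implies $X=0$ or $Y=0$. A factorisation of $G$ is an expression $G=A_1+\dots+A_k$ ($k\ge0$) with atoms $A_i$, considered up to reordering and replacing atoms by equal ones; $G$ is uniquely factorisable if it has exactly one factorisation. For Left dead ends, $P\mid X$ means $X=P+Y$ for some Left dead end $Y$; a prime is a Left dead end $P\neq0$ such that $P\mid X+Y$ implies $P\mid X$ or $P\mid Y$. A Left dead end is prime-factorisable if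 it has a factorisation consisting only of primes (the empty sum, i.e. $0$, included). -}

module Defs where

open import Data.Nat using (ℕ; zero; suc) renaming (_+_ to _+ℕ_)
open import Data.Fin using (Fin; splitAt)
open import Data.Bool using (Bool; true; false; not; _∨_; _∧_)
open import Data.Sum using (_⊎_; [_,_]′)
open import Data.Product using (Σ; _×_; _,_)
open import Data.Empty using (⊥)
open import Data.Unit using (⊤)
open import Data.List using (List; []; _∷_)
open import Data.List.Relation.Unary.All using (All)
open import Data.List.Relation.Binary.Pointwise using (Pointwise)
open import Data.List.Relation.Binary.Permutation.Propositional using (_↭_)
open import Relation.Binary.PropositionalEquality using (_≡_)
open import Relation.Nullary using (¬_)

-- Short partizan game forms: finitely many Left options (indexed by
-- Fin nL) and finitely many Right options (indexed by Fin nR).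

data Game : Set where
  mk : (nL : ℕ) → (Fin nL → Game) → (nR : ℕ) → (Fin nR → Game) → Game

zeroG : Game
zeroG = mk 0 (λ ()) 0 (λ ())

infixl 6 _+_
_+_ : Game → Game → Game
mk a f b g + mk c h d k =
  mk (a +ℕ c) (λ x → [ (λ i → f i + mk c h d k) , (λ j → mk a f b g + h j) ]′ (splitAt a x))
     (b +ℕ d) (λ x → [ (λ i → g i + mk c h d k) , (λ j → mk a f b g + k j) ]′ (splitAt b x))

anyFin : (n : ℕ) → (Fin n → Bool) → Bool
anyFin zero    p = false
anyFin (suc n) p = p Fin.zero ∨ anyFin n (λ i → p (Fin.suc i))
  where import Data.Fin as Fin

isZero : ℕ → Bool
isZero zero    = true
isZero (suc _) = false

-- leftWinsFirst G  : Left, moving first in G, wins (misère play)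
-- rightWinsFirst G : Right, moving first in G, wins (misère play)
leftWinsFirst  : Game → Bool
rightWinsFirst : Game → Bool
leftWinsFirst  (mk a f b g) = isZero a ∨ anyFin a (λ i → not (rightWinsFirst (f i)))
rightWinsFirst (mk a f b g) = isZero b ∨ anyFin b (λ j → not (leftWinsFirst (g j)))

data Outcome : Set where
  𝓛 𝓝 𝓟 𝓡 : Outcome

outcome : Game → Outcome
outcome G with leftWinsFirst G | rightWinsFirst G
... | true  | false = 𝓛
... | true  | true  = 𝓝
... | false | false = 𝓟
... | false | true  = 𝓡

data _≤o_ : Outcome → Outcome → Set where
  o-refl : ∀ {o} → o ≤o o
  R≤ : ∀ {o} → 𝓡 ≤o o
  ≤L : ∀ {o} → o ≤o 𝓛

infix 4 _≥g_ _≡g_ _>g_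
_≥g_ : Game → Game → Set
G ≥g H = (X : Game) → outcome (H + X) ≤o outcome (G + X)

_≡g_ : Game → Game → Set
G ≡g H = (G ≥g H) × (H ≥g G)

_>g_ : Game → Game → Set
G >g H = (G ≥g H) × ¬ (G ≡g H)

IsOption : Game → Game → Set
IsOption O (mk a f b g) = (Σ (Fin a) λ i → f i ≡ O) ⊎ (Σ (Fin b) λ j → g j ≡ O)

IsGoodOption : Game → Game → Set
IsGoodOption O G = IsOption O G × ((O'' : Game) → IsOption O'' G → ¬ (O >g O''))

IsLeftDeadEnd : Game → Set
IsLeftDeadEnd (mk a f b g) = (a ≡ 0) × ((j : Fin b) → IsLeftDeadEnd (g j))

IsAtom : Game → Set
IsAtom A = IsLeftDeadEnd A × ¬ (A ≡g zeroG)
  × ((X Y : Game) → IsLeftDeadEnd X → IsLeftDeadEnd Y → A ≡g X + Y → (X ≡g zeroG) ⊎ (Y ≡g zeroG))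

infix 4 _∣g_
_∣g_ : Game → Game → Set
P ∣g X = Σ Game λ Y → IsLeftDeadEnd Y × (X ≡g P + Y)

IsPrime : Game → Set
IsPrime P = IsLeftDeadEnd P × ¬ (P ≡g zeroG)
  × ((X Y : Game) → IsLeftDeadEnd X → IsLeftDeadEnd Y → P ∣g X + Y → (P ∣g X) ⊎ (P ∣g Y))

sumG : List Game → Game
sumG []       = zeroG
sumG (x ∷ []) = x
sumG (x ∷ xs) = x + sumG xs

IsFactorisation : Game → List Game → Set
IsFactorisation G As = All IsAtom As × (G ≡g sumG As)

SameFactorisation : List Game → List Game → Set
SameFactorisation As Bs = Σ (List Game) λ Cs → (As ↭ Cs) × Pointwise _≡g_ Cs Bs

IsUniquelyFactorisable : Game → Set
IsUniquelyFactorisable G = (Σ (List Game) λ As → IsFactorisation G As)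
  × ((As Bs : List Game) → IsFactorisation G As → IsFactorisation G Bs → SameFactorisation As Bs)

IsPrimeFactorisable : Game → Set
IsPrimeFactorisable G = Σ (List Game) λ Ps → IsFactorisation G Ps × All IsPrime Ps

SuffixCondition : Game → List Game → Set
SuffixCondition Gi rest = Σ Game λ Gi' →
  IsOption Gi' Gi × IsPrimeFactorisable Gi' × IsGoodOption (sumG (Gi' ∷ rest)) (sumG (Gi ∷ rest))

AllSuffixes : List Game → Set
AllSuffixes []       = ⊤
AllSuffixes (x ∷ xs) = SuffixCondition x xs × AllSuffixes xs

{-# OPTIONS --safe #-}
module Submission where

-- Among Left dead ends the misère order only depends on Right options: G ⊒ H iff H has no
-- Right option when G has none and every Right option of G is ⊒ some Right option of H.
-- One direction is a direct strategy argument. For the other, a failure of the condition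
-- yields a dead-ending game D such that Right, moving first, wins G + D but not H + D.
-- A Left dead end K is invertible modulo dead-ending games (Y + K + −K has the winners of Y:
-- answer moves in K and −K by their mirror images, and once Y is exhausted race down a shortest
-- Right run of K), so D + −K separates G + K from H + K as well. Hence Left dead ends form a
-- cancellative conical monoid, and a good option of a sum ∑Cs of atoms equals one of its Right
-- options B′ + ∑Rest, where B ∷ Rest is a permutation of Cs and B′ is a Right option of B.
--
-- Unique factorisation then follows by induction along G₁ + (G₂ + ⋯ + Gₖ). Write H for the
-- tail, uniquely factorisable by induction, and let G₁ + H = ∑Cs. Its good option G₁′ + H, with
-- G₁′ = ∑Ps a sum of primes, equals some B′ + R as above, R = ∑Rest. A prime P of Ps divides
-- B′ + R. If P ∣ B′, cancel P and continue with fewer primes. Otherwise P equals an atom of Rest,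
-- so P ∣ G₁ + H = B + R: either G₁ = P, and then H = B + (R − P) has a unique factorisation, or
-- P equals an atom of H and cancelling it on both sides shortens H. With no primes left,
-- H = B′ + R gives G₁ + B′ = B, so B′ = 0 and G₁ = B because B is an atom.

open import Defs
open import Algebra.Bundles using (CommutativeMonoid)
open import Algebra.Structures using (IsCommutativeMonoid)
open import Data.Bool using (Bool; true; false; not; _∨_; T; T?)
open import Data.Bool.Properties using (T-∨)
open import Data.Empty using (⊥-elim)
open import Data.Fin using (Fin; zero; suc; splitAt; _↑ˡ_; _↑ʳ_)
open import Data.Fin.Properties using (splitAt-↑ˡ; splitAt-↑ʳ; ¬Fin0; all?; any?; ¬∀⟶∃¬)
open import Data.List using (List; []; _∷_; foldr; length)
open import Data.List.Relation.Binary.Permutation.Propositional as ↭ using (_↭_)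
import Data.List.Relation.Binary.Permutation.Propositional.Properties as ↭
open import Data.List.Relation.Binary.Pointwise as Pointwise using (Pointwise; []; _∷_)
open import Data.List.Relation.Unary.All as All using (All; []; _∷_)
open import Data.Nat using (ℕ; zero; suc; _≟_; _≤_; _<_; _≤?_; z≤n; s≤s) renaming (_+_ to _+ℕ_)
open import Data.Nat.Induction using (<-wellFounded)
open import Data.Nat.Properties using (m+n≡0⇒m≡0; m+n≡0⇒n≡0; n≤1+n; ≤-refl; ≤-reflexive; ≤-trans; <⇒≤; ≰⇒>)
open import Data.Product using (∃₂; ∃-syntax; _×_; _,_; proj₁; proj₂)
open import Data.Sum using (_⊎_; inj₁; inj₂; [_,_]′)
open import Data.Unit using (⊤; tt)
open import Function using (_∘_; id; Equivalence)
import Induction.WellFounded as WF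
open import Level using (0ℓ)
open import Relation.Binary.Bundles using (Setoid)
import Relation.Binary.Construct.On as On
open import Relation.Binary.PropositionalEquality using (_≡_; refl; sym; trans; cong; cong₂; subst)
import Relation.Binary.Reasoning.Setoid as SetoidReasoning
open import Relation.Nullary using (¬_; Dec; yes; no)
open import Relation.Nullary.Decidable using (_×-dec_; _→-dec_; map′; decidable-stable)

-- Players, options, first-player wins and the misère order

data Player : Set where
  Left Right : Player

opponent : Player → Player
opponent Left  = Right
opponent Right = Left

#opts : Player → Game → ℕ
#opts Left  (mk a _ _ _) = a
#opts Right (mk _ _ b _) = b

opt : (p : Player) (G : Game) → Fin (#opts p G) → Game
opt Left  (mk _ f _ _) = f
opt Right (mk _ _ _ g) = g

winsFirst : Player → Game → Bool
winsFirst Left  = leftWinsFirst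
winsFirst Right = rightWinsFirst

-- A record rather than `T (winsFirst p G)`, so that p and G can be inferred.
record Wins (p : Player) (G : Game) : Set where
  constructor wins
  field isWin : T (winsFirst p G)

winsFirst-unfold : ∀ p G → winsFirst p G ≡
  isZero (#opts p G) ∨ anyFin (#opts p G) (λ i → not (winsFirst (opponent p) (opt p G i)))
winsFirst-unfold Left  (mk _ _ _ _) = refl
winsFirst-unfold Right (mk _ _ _ _) = refl

T-isZero⇒≡0 : ∀ {n} → T (isZero n) → n ≡ 0
T-isZero⇒≡0 {zero} _ = refl

T-not⇒¬T : ∀ {b} → T (not b) → ¬ T b
T-not⇒¬T {false} _ ()

¬T⇒T-not : ∀ {b} → ¬ T b → T (not b)
¬T⇒T-not {false} _  = tt
¬T⇒T-not {true}  ¬t = ¬t tt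

anyFin-witness : ∀ n (b : Fin n → Bool) → T (anyFin n b) → ∃[ i ] T (b i)
anyFin-witness (suc n) b t with Equivalence.to T-∨ t
... | inj₁ t₀ = zero , t₀
... | inj₂ tₛ = let i , tᵢ = anyFin-witness n (b ∘ suc) tₛ in suc i , tᵢ

anyFin-intro : ∀ n (b : Fin n → Bool) i → T (b i) → T (anyFin n b)
anyFin-intro (suc n) b zero    t = Equivalence.from T-∨ (inj₁ t)
anyFin-intro (suc n) b (suc i) t = Equivalence.from T-∨ (inj₂ (anyFin-intro n (b ∘ suc) i t))

data Win (p : Player) (G : Game) : Set where
  noMove : #opts p G ≡ 0 → Win p G
  move   : (i : Fin (#opts p G)) → ¬ Wins (opponent p) (opt p G i) → Win p G

Wins⇒Win : ∀ {p G} → Wins p G → Win p G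
Wins⇒Win {p} {G} (wins w) with Equivalence.to T-∨ (subst T (winsFirst-unfold p G) w)
... | inj₁ t = noMove (T-isZero⇒≡0 t)
... | inj₂ t = let i , tᵢ = anyFin-witness _ _ t in move i (T-not⇒¬T tᵢ ∘ Wins.isWin)

Win⇒Wins : ∀ {p G} → Win p G → Wins p G
Win⇒Wins {p} {G} w = wins (subst T (sym (winsFirst-unfold p G)) (Equivalence.from T-∨ (reason w)))
  where
  reason : Win p G → T (isZero (#opts p G)) ⊎ T (anyFin (#opts p G) (λ i → not (winsFirst (opponent p) (opt p G i))))
  reason (noMove z)  = inj₁ (subst (T ∘ isZero) (sym z) tt)
  reason (move i ¬w) = inj₂ (anyFin-intro _ _ i (¬T⇒T-not (¬w ∘ wins)))

wins? : ∀ p G → Dec (Wins p G)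
wins? p G = map′ wins Wins.isWin (T? (winsFirst p G))

#opts-+ : ∀ p G K → #opts p (G + K) ≡ #opts p G +ℕ #opts p K
#opts-+ Left  (mk _ _ _ _) (mk _ _ _ _) = refl
#opts-+ Right (mk _ _ _ _) (mk _ _ _ _) = refl

opt-+ˡ : ∀ p G K (i : Fin (#opts p G)) → ∃[ x ] opt p (G + K) x ≡ opt p G i + K
opt-+ˡ Left G@(mk a _ _ _) K@(mk c _ _ _) i = i ↑ˡ c , eq
  where
  eq : opt Left (G + K) (i ↑ˡ c) ≡ opt Left G i + K
  eq rewrite splitAt-↑ˡ a i c = refl
opt-+ˡ Right G@(mk _ _ b _) K@(mk _ _ d _) i = i ↑ˡ d , eq
  where
  eq : opt Right (G + K) (i ↑ˡ d) ≡ opt Right G i + K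
  eq rewrite splitAt-↑ˡ b i d = refl

opt-+ʳ : ∀ p G K (j : Fin (#opts p K)) → ∃[ x ] opt p (G + K) x ≡ G + opt p K j
opt-+ʳ Left G@(mk a _ _ _) K@(mk c _ _ _) j = a ↑ʳ j , eq
  where
  eq : opt Left (G + K) (a ↑ʳ j) ≡ G + opt Left K j
  eq rewrite splitAt-↑ʳ a c j = refl
opt-+ʳ Right G@(mk _ _ b _) K@(mk _ _ d _) j = b ↑ʳ j , eq
  where
  eq : opt Right (G + K) (b ↑ʳ j) ≡ G + opt Right K j
  eq rewrite splitAt-↑ʳ b d j = refl

opt-+-split : ∀ p G K (x : Fin (#opts p (G + K))) →
  (∃[ i ] opt p (G + K) x ≡ opt p G i + K) ⊎ (∃[ j ] opt p (G + K) x ≡ G + opt p K j)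
opt-+-split Left (mk a _ _ _) (mk _ _ _ _) x with splitAt a x
... | inj₁ i = inj₁ (i , refl)
... | inj₂ j = inj₂ (j , refl)
opt-+-split Right (mk _ _ b _) (mk _ _ _ _) x with splitAt b x
... | inj₁ i = inj₁ (i , refl)
... | inj₂ j = inj₂ (j , refl)

data Win+ (p : Player) (G K : Game) : Set where
  noMove : #opts p G ≡ 0 → #opts p K ≡ 0 → Win+ p G K
  moveˡ  : (i : Fin (#opts p G)) → ¬ Wins (opponent p) (opt p G i + K) → Win+ p G K
  moveʳ  : (j : Fin (#opts p K)) → ¬ Wins (opponent p) (G + opt p K j) → Win+ p G K

Wins⇒Win+ : ∀ {p G K} → Wins p (G + K) → Win+ p G K
Wins⇒Win+ {p} {G} {K} w with Wins⇒Win w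
... | noMove z = let z′ = trans (sym (#opts-+ p G K)) z in
                 noMove (m+n≡0⇒m≡0 _ z′) (m+n≡0⇒n≡0 (#opts p G) z′)
... | move x ¬w with opt-+-split p G K x
...   | inj₁ (i , eq) = moveˡ i (subst (¬_ ∘ Wins (opponent p)) eq ¬w)
...   | inj₂ (j , eq) = moveʳ j (subst (¬_ ∘ Wins (opponent p)) eq ¬w)

Win+⇒Wins : ∀ {p G K} → Win+ p G K → Wins p (G + K)
Win+⇒Wins {p} {G} {K} (noMove zG zK) =
  Win⇒Wins (noMove (trans (#opts-+ p G K) (cong₂ _+ℕ_ zG zK)))
Win+⇒Wins {p} {G} {K} (moveˡ i ¬w) =
  let x , eq = opt-+ˡ p G K i in Win⇒Wins (move x (subst (¬_ ∘ Wins (opponent p)) (sym eq) ¬w))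
Win+⇒Wins {p} {G} {K} (moveʳ j ¬w) =
  let x , eq = opt-+ʳ p G K j in Win⇒Wins (move x (subst (¬_ ∘ Wins (opponent p)) (sym eq) ¬w))

Wins-moveˡˡ : ∀ {p} G K L i → ¬ Wins (opponent p) ((opt p G i + K) + L) → Wins p ((G + K) + L)
Wins-moveˡˡ {p} G K L i ¬w =
  let x , eq = opt-+ˡ p G K i in Win+⇒Wins (moveˡ x (subst (λ A → ¬ Wins (opponent p) (A + L)) (sym eq) ¬w))

Wins-moveˡʳ : ∀ {p} G K L j → ¬ Wins (opponent p) ((G + opt p K j) + L) → Wins p ((G + K) + L)
Wins-moveˡʳ {p} G K L j ¬w =
  let x , eq = opt-+ʳ p G K j in Win+⇒Wins (moveˡ x (subst (λ A → ¬ Wins (opponent p) (A + L)) (sym eq) ¬w))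

winsIn : Player → Outcome → Bool
winsIn Left  𝓛 = true
winsIn Left  𝓝 = true
winsIn Left  _ = false
winsIn Right 𝓝 = true
winsIn Right 𝓡 = true
winsIn Right _ = false

winsIn-outcome : ∀ p G → winsIn p (outcome G) ≡ winsFirst p G
winsIn-outcome Left G with leftWinsFirst G | rightWinsFirst G
... | true  | false = refl
... | true  | true  = refl
... | false | false = refl
... | false | true  = refl
winsIn-outcome Right G with leftWinsFirst G | rightWinsFirst G
... | true  | false = refl
... | true  | true  = refl
... | false | false = refl
... | false | true  = refl

Wins⇒winsIn : ∀ {p G} → Wins p G → T (winsIn p (outcome G))
Wins⇒winsIn {p} {G} (wins w) = subst T (sym (winsIn-outcome p G)) w

winsIn⇒Wins : ∀ p G → T (winsIn p (outcome G)) → Wins p G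
winsIn⇒Wins p G t = wins (subst T (winsIn-outcome p G) t)

_≤ʷ_ : Outcome → Outcome → Set
o ≤ʷ o′ = (T (winsIn Left o) → T (winsIn Left o′)) × (T (winsIn Right o′) → T (winsIn Right o))

≤o⇒≤ʷ : ∀ {o o′} → o ≤o o′ → o ≤ʷ o′
≤o⇒≤ʷ o-refl = id , id
≤o⇒≤ʷ R≤     = (λ ()) , (λ _ → tt)
≤o⇒≤ʷ ≤L     = (λ _ → tt) , (λ ())

≤ʷ⇒≤o : ∀ {o o′} → o ≤ʷ o′ → o ≤o o′
≤ʷ⇒≤o {𝓡}      _       = R≤
≤ʷ⇒≤o {o′ = 𝓛} _       = ≤L
≤ʷ⇒≤o {𝓝} {𝓝}  _       = o-refl
≤ʷ⇒≤o {𝓟} {𝓟}  _       = o-refl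
≤ʷ⇒≤o {𝓛} {𝓝}  (_ , r) = ⊥-elim (r tt)
≤ʷ⇒≤o {𝓛} {𝓟}  (l , _) = ⊥-elim (l tt)
≤ʷ⇒≤o {𝓛} {𝓡}  (l , _) = ⊥-elim (l tt)
≤ʷ⇒≤o {𝓝} {𝓟}  (l , _) = ⊥-elim (l tt)
≤ʷ⇒≤o {𝓝} {𝓡}  (l , _) = ⊥-elim (l tt)
≤ʷ⇒≤o {𝓟} {𝓝}  (_ , r) = ⊥-elim (r tt)
≤ʷ⇒≤o {𝓟} {𝓡}  (_ , r) = ⊥-elim (r tt)

infix 4 _≼ₒ_ _≅_ _⊒_ _≈_ _≽_ _≽?_

_≼ₒ_ : Game → Game → Set
A ≼ₒ B = (Wins Left A → Wins Left B) × (Wins Right B → Wins Right A)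

≤o⇒≼ₒ : ∀ {A B} → outcome A ≤o outcome B → A ≼ₒ B
≤o⇒≼ₒ {A} {B} A≤B = let l , r = ≤o⇒≤ʷ A≤B in
  winsIn⇒Wins Left B ∘ l ∘ Wins⇒winsIn , winsIn⇒Wins Right A ∘ r ∘ Wins⇒winsIn

≼ₒ⇒≤o : ∀ {A B} → A ≼ₒ B → outcome A ≤o outcome B
≼ₒ⇒≤o {A} {B} (l , r) = ≤ʷ⇒≤o (Wins⇒winsIn ∘ l ∘ winsIn⇒Wins Left A , Wins⇒winsIn ∘ r ∘ winsIn⇒Wins Right B)

≼ₒ-trans : ∀ {A B C} → A ≼ₒ B → B ≼ₒ C → A ≼ₒ C
≼ₒ-trans (l , r) (l′ , r′) = l′ ∘ l , r ∘ r′

-- Bisimilar game forms and the commutative monoid of games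

Forth : (Game → Game → Set) → Game → Game → Set
Forth R X Y = ∀ p x → ∃[ y ] R (opt p X x) (opt p Y y)

data _≅_ (X Y : Game) : Set where
  bisim : Forth _≅_ X Y → Forth (λ A B → B ≅ A) Y X → X ≅ Y

Fin→Fin0⇒≡0 : ∀ {m n} → (Fin m → Fin n) → n ≡ 0 → m ≡ 0
Fin→Fin0⇒≡0 {zero}  _ _    = refl
Fin→Fin0⇒≡0 {suc m} f refl with f zero
... | ()

≅-wins  : ∀ {p X Y} → X ≅ Y → Wins p X → Wins p Y
≅-wins⁻ : ∀ {p X Y} → X ≅ Y → Wins p Y → Wins p X
≅-wins {p} (bisim forth back) w with Wins⇒Win w
... | noMove z  = Win⇒Wins (noMove (Fin→Fin0⇒≡0 (λ y → proj₁ (back p y)) z))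
... | move x ¬w = let y , s = forth p x in Win⇒Wins (move y (¬w ∘ ≅-wins⁻ s))
≅-wins⁻ {p} (bisim forth back) w with Wins⇒Win w
... | noMove z  = Win⇒Wins (noMove (Fin→Fin0⇒≡0 (λ x → proj₁ (forth p x)) z))
... | move y ¬w = let x , s = back p y in Win⇒Wins (move x (¬w ∘ ≅-wins s))

≅⇒≼ₒ : ∀ {X Y} → X ≅ Y → X ≼ₒ Y
≅⇒≼ₒ s = ≅-wins s , ≅-wins⁻ s

≅-sym : ∀ {X Y} → X ≅ Y → Y ≅ X
≅-sym (bisim forth back) =
  bisim (λ p y → let x , s = back p y in x , ≅-sym s) (λ p x → let y , s = forth p x in y , ≅-sym s)

module _ {R : Game → Game → Set}
         (forth : ∀ {X Y} → R X Y → Forth R X Y)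
         (back  : ∀ {X Y} → R X Y → Forth (λ A B → R B A) Y X) where

  -- Splitting on the player lets `opt p X x` reduce to a subterm of X, as the termination
  -- checker requires.
  bisimulation⇒≅ : ∀ X Y → R X Y → X ≅ Y
  bisimulation⇒≅ (mk _ f _ g) Y r = bisim
    (λ { Left  x → proj₁ (forth r Left x) , bisimulation⇒≅ (f x) _ (proj₂ (forth r Left x))
       ; Right x → proj₁ (forth r Right x) , bisimulation⇒≅ (g x) _ (proj₂ (forth r Right x)) })
    (λ { Left  y → proj₁ (back r Left y) , bisimulation⇒≅ (f (proj₁ (back r Left y))) _ (proj₂ (back r Left y))
       ; Right y → proj₁ (back r Right y) , bisimulation⇒≅ (g (proj₁ (back r Right y))) _ (proj₂ (back r Right y)) })

symmetricBisimulation⇒≅ : ∀ {R} → (∀ {X Y} → R X Y → R Y X) → (∀ {X Y} → R X Y → Forth R X Y) →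
                          ∀ {X Y} → R X Y → X ≅ Y
symmetricBisimulation⇒≅ R-sym forth =
  bisimulation⇒≅ forth (λ r p y → let x , r′ = forth (R-sym r) p y in x , R-sym r′) _ _

≅-refl : ∀ {X} → X ≅ X
≅-refl = symmetricBisimulation⇒≅ sym forth refl
  where
  forth : ∀ {X Y} → X ≡ Y → Forth _≡_ X Y
  forth refl p x = x , refl

data Swapped (X Y : Game) : Set where
  swapped : ∀ G K → X ≡ G + K → Y ≡ K + G → Swapped X Y

+-comm-≅ : ∀ G K → G + K ≅ K + G
+-comm-≅ G K = symmetricBisimulation⇒≅ swapped-sym forth (swapped G K refl refl)
  where
  swapped-sym : ∀ {X Y} → Swapped X Y → Swapped Y X
  swapped-sym (swapped G K eq eq′) = swapped K G eq′ eq
  forth : ∀ {X Y} → Swapped X Y → Forth Swapped X Y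
  forth (swapped G K refl refl) p x with opt-+-split p G K x
  ... | inj₁ (i , eq) = let y , eq′ = opt-+ʳ p K G i in y , swapped _ _ eq eq′
  ... | inj₂ (j , eq) = let y , eq′ = opt-+ˡ p K G j in y , swapped _ _ eq eq′

data Summed (X Y : Game) : Set where
  summed : ∀ {G H K M} → G ≅ H → K ≅ M → X ≡ G + K → Y ≡ H + M → Summed X Y

+-cong-≅ : ∀ {G H K M} → G ≅ H → K ≅ M → G + K ≅ H + M
+-cong-≅ s t = symmetricBisimulation⇒≅ summed-sym forth (summed s t refl refl)
  where
  summed-sym : ∀ {X Y} → Summed X Y → Summed Y X
  summed-sym (summed s t eq eq′) = summed (≅-sym s) (≅-sym t) eq′ eq
  forth : ∀ {X Y} → Summed X Y → Forth Summed X Y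
  forth (summed {G} {H} {K} {M} s@(bisim sF _) t@(bisim tF _) refl refl) p x with opt-+-split p G K x
  ... | inj₁ (i , eq) = let j , s′ = sF p i ; y , eq′ = opt-+ˡ p H M j in y , summed s′ t eq eq′
  ... | inj₂ (i , eq) = let j , t′ = tF p i ; y , eq′ = opt-+ʳ p H M j in y , summed s t′ eq eq′

+-identityʳ-≅ : ∀ G → G + zeroG ≅ G
+-identityʳ-≅ G = bisimulation⇒≅ forth back (G + zeroG) G refl
  where
  forth : ∀ {X Y} → X ≡ Y + zeroG → Forth (λ A B → A ≡ B + zeroG) X Y
  forth {Y = Y} refl p x with opt-+-split p Y zeroG x
  ... | inj₁ (y , eq) = y , eq
  forth refl Left  x | inj₂ (() , _)
  forth refl Right x | inj₂ (() , _)
  back : ∀ {X Y} → X ≡ Y + zeroG → Forth (λ A B → B ≡ A + zeroG) Y X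
  back {Y = Y} refl p y = opt-+ˡ p Y zeroG y

data Reassociated (X Y : Game) : Set where
  reassociated : ∀ G H K → X ≡ (G + H) + K → Y ≡ G + (H + K) → Reassociated X Y

+-assoc-≅ : ∀ G H K → (G + H) + K ≅ G + (H + K)
+-assoc-≅ G H K = bisimulation⇒≅ forth back _ _ (reassociated G H K refl refl)
  where
  forth : ∀ {X Y} → Reassociated X Y → Forth Reassociated X Y
  forth (reassociated G H K refl refl) p x with opt-+-split p (G + H) K x
  ... | inj₂ (k , eq) =
    let z , eqz = opt-+ʳ p H K k ; y , eqy = opt-+ʳ p G (H + K) z in
    y , reassociated _ _ _ eq (trans eqy (cong (G +_) eqz))
  ... | inj₁ (w , eq) with opt-+-split p G H w
  ...   | inj₁ (i , eqw) =
    let y , eqy = opt-+ˡ p G (H + K) i in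
    y , reassociated _ _ _ (trans eq (cong (_+ K) eqw)) eqy
  ...   | inj₂ (j , eqw) =
    let z , eqz = opt-+ˡ p H K j ; y , eqy = opt-+ʳ p G (H + K) z in
    y , reassociated _ _ _ (trans eq (cong (_+ K) eqw)) (trans eqy (cong (G +_) eqz))
  back : ∀ {X Y} → Reassociated X Y → Forth (λ A B → Reassociated B A) Y X
  back (reassociated G H K refl refl) p y with opt-+-split p G (H + K) y
  ... | inj₁ (i , eq) =
    let w , eqw = opt-+ˡ p G H i ; x , eqx = opt-+ˡ p (G + H) K w in
    x , reassociated _ _ _ (trans eqx (cong (_+ K) eqw)) eq
  ... | inj₂ (z , eq) with opt-+-split p H K z
  ...   | inj₁ (j , eqz) =
    let w , eqw = opt-+ʳ p G H j ; x , eqx = opt-+ˡ p (G + H) K w in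
    x , reassociated _ _ _ (trans eqx (cong (_+ K) eqw)) (trans eq (cong (G +_) eqz))
  ...   | inj₂ (k , eqz) =
    let x , eqx = opt-+ʳ p (G + H) K k in
    x , reassociated _ _ _ eqx (trans eq (cong (G +_) eqz))

-- Wrappers around `_≥g_` and `_≡g_`, whose unfolded forms do not determine the two games.
record _⊒_ (G H : Game) : Set where
  constructor fromGe
  field toGe : G ≥g H

record _≈_ (G H : Game) : Set where
  constructor fromEq
  field toEq : G ≡g H

⊒-intro : ∀ {G H} → (∀ X → H + X ≼ₒ G + X) → G ⊒ H
⊒-intro f = fromGe (λ X → ≼ₒ⇒≤o (f X))

⊒-elim : ∀ {G H} → G ⊒ H → ∀ X → H + X ≼ₒ G + X
⊒-elim (fromGe p) X = ≤o⇒≼ₒ (p X)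

⊒⇒≼ₒ : ∀ {G H} → G ⊒ H → H ≼ₒ G
⊒⇒≼ₒ {G} {H} G⊒H =
  ≼ₒ-trans (≅⇒≼ₒ (≅-sym (+-identityʳ-≅ H))) (≼ₒ-trans (⊒-elim G⊒H zeroG) (≅⇒≼ₒ (+-identityʳ-≅ G)))

⊒-refl : ∀ {G} → G ⊒ G
⊒-refl = ⊒-intro (λ _ → id , id)

⊒-trans : ∀ {G H K} → G ⊒ H → H ⊒ K → G ⊒ K
⊒-trans G⊒H H⊒K = ⊒-intro (λ X → ≼ₒ-trans (⊒-elim H⊒K X) (⊒-elim G⊒H X))

⊒-+ʳ : ∀ {G H} K → G ⊒ H → G + K ⊒ H + K
⊒-+ʳ {G} {H} K G⊒H = ⊒-intro λ X →
  ≼ₒ-trans (≅⇒≼ₒ (+-assoc-≅ H K X)) (≼ₒ-trans (⊒-elim G⊒H (K + X)) (≅⇒≼ₒ (≅-sym (+-assoc-≅ G K X))))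

≅⇒⊒ : ∀ {G H} → G ≅ H → G ⊒ H
≅⇒⊒ s = ⊒-intro (λ X → ≅⇒≼ₒ (+-cong-≅ (≅-sym s) ≅-refl))

≈⇒⊒ : ∀ {G H} → G ≈ H → G ⊒ H
≈⇒⊒ (fromEq (G≥H , _)) = fromGe G≥H

≈⇒⊑ : ∀ {G H} → G ≈ H → H ⊒ G
≈⇒⊑ (fromEq (_ , H≥G)) = fromGe H≥G

⊒-antisym : ∀ {G H} → G ⊒ H → H ⊒ G → G ≈ H
⊒-antisym (fromGe G≥H) (fromGe H≥G) = fromEq (G≥H , H≥G)

≅⇒≈ : ∀ {G H} → G ≅ H → G ≈ H
≅⇒≈ s = ⊒-antisym (≅⇒⊒ s) (≅⇒⊒ (≅-sym s))

≡⇒≈ : ∀ {G H} → G ≡ H → G ≈ H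
≡⇒≈ refl = ⊒-antisym ⊒-refl ⊒-refl

≈-refl : ∀ {G} → G ≈ G
≈-refl = ≡⇒≈ refl

≈-sym : ∀ {G H} → G ≈ H → H ≈ G
≈-sym G≈H = ⊒-antisym (≈⇒⊑ G≈H) (≈⇒⊒ G≈H)

≈-trans : ∀ {G H K} → G ≈ H → H ≈ K → G ≈ K
≈-trans G≈H H≈K = ⊒-antisym (⊒-trans (≈⇒⊒ G≈H) (≈⇒⊒ H≈K)) (⊒-trans (≈⇒⊑ H≈K) (≈⇒⊑ G≈H))

≈-rightWins : ∀ {G H} → G ≈ H → Wins Right G → Wins Right H
≈-rightWins G≈H = proj₂ (⊒⇒≼ₒ (≈⇒⊒ G≈H))

+-comm-≈ : ∀ G K → G + K ≈ K + G
+-comm-≈ G K = ≅⇒≈ (+-comm-≅ G K)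

≈-+ʳ : ∀ {G H} K → G ≈ H → G + K ≈ H + K
≈-+ʳ K G≈H = ⊒-antisym (⊒-+ʳ K (≈⇒⊒ G≈H)) (⊒-+ʳ K (≈⇒⊑ G≈H))

+-isCommutativeMonoid : IsCommutativeMonoid _≈_ _+_ zeroG
+-isCommutativeMonoid = record
  { isMonoid = record
    { isSemigroup = record
      { isMagma = record
        { isEquivalence = record { refl = ≈-refl ; sym = ≈-sym ; trans = ≈-trans }
        ; ∙-cong = λ {G} {H} {K} {M} G≈H K≈M →
            ≈-trans (≈-+ʳ K G≈H) (≈-trans (+-comm-≈ H K) (≈-trans (≈-+ʳ H K≈M) (+-comm-≈ M H)))
        }
      ; assoc = λ G H K → ≅⇒≈ (+-assoc-≅ G H K)
      }
    ; identity = (λ G → ≈-trans (+-comm-≈ zeroG G) (≅⇒≈ (+-identityʳ-≅ G))) , (λ G → ≅⇒≈ (+-identityʳ-≅ G))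
    }
  ; comm = +-comm-≈
  }

+-commutativeMonoid : CommutativeMonoid 0ℓ 0ℓ
+-commutativeMonoid = record { isCommutativeMonoid = +-isCommutativeMonoid }

open CommutativeMonoid +-commutativeMonoid
  using () renaming (setoid to ≈-setoid; ∙-congˡ to +-congˡ; ∙-congʳ to +-congʳ; assoc to +-assoc;
                     identityˡ to +-identityˡ; identityʳ to +-identityʳ)
open import Algebra.Solver.CommutativeMonoid +-commutativeMonoid using (solve; _⊜_; _⊕_)

-- Left dead ends and their order

lde-noLeft : ∀ G → IsLeftDeadEnd G → #opts Left G ≡ 0
lde-noLeft (mk _ _ _ _) (z , _) = z

lde-right : ∀ G → IsLeftDeadEnd G → ∀ j → IsLeftDeadEnd (opt Right G j)
lde-right (mk _ _ _ _) (_ , ds) = ds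

lde-zero : IsLeftDeadEnd zeroG
lde-zero = refl , λ ()

lde-+ : ∀ G H → IsLeftDeadEnd G → IsLeftDeadEnd H → IsLeftDeadEnd (G + H)
lde-+ G@(mk _ _ _ g) H@(mk _ _ _ k) dG@(refl , dsG) dH@(refl , dsH) = refl , λ x →
  [ (λ (i , eq) → subst IsLeftDeadEnd (sym eq) (lde-+ (g i) H (dsG i) dH))
  , (λ (j , eq) → subst IsLeftDeadEnd (sym eq) (lde-+ G (k j) dG (dsH j))) ]′ (opt-+-split Right G H x)

leftWins-+zero : ∀ G → IsLeftDeadEnd G → Wins Left (G + zeroG)
leftWins-+zero G dG = Win+⇒Wins (noMove (lde-noLeft G dG) refl)

_≽_ : Game → Game → Set
mk _ _ b g ≽ H = (b ≡ 0 → #opts Right H ≡ 0) × (∀ i → ∃[ j ] g i ≽ opt Right H j)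

_≽?_ : ∀ G H → Dec (G ≽ H)
mk _ _ b g ≽? H = (b ≟ 0 →-dec #opts Right H ≟ 0) ×-dec all? (λ i → any? (λ j → g i ≽? opt Right H j))

≽-trans : ∀ G H K → G ≽ H → H ≽ K → G ≽ K
≽-trans (mk _ _ _ g) (mk _ _ _ k) K (zGH , GH) (zHK , HK) = zHK ∘ zGH , λ i →
  let j , gᵢ≽kⱼ = GH i ; l , kⱼ≽Kₗ = HK j in l , ≽-trans (g i) (k j) (opt Right K l) gᵢ≽kⱼ kⱼ≽Kₗ

leftWins-≽  : ∀ G H X → IsLeftDeadEnd G → IsLeftDeadEnd H → G ≽ H → Win+ Left H X → Wins Left (G + X)
rightWins-≽ : ∀ G H X → IsLeftDeadEnd G → IsLeftDeadEnd H → G ≽ H → Win+ Right G X → Wins Right (H + X)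
leftWins-≽ G H X dG dH G≽H (noMove _ zX) = Win+⇒Wins (noMove (lde-noLeft G dG) zX)
leftWins-≽ G H X dG dH G≽H (moveˡ i _)   = ⊥-elim (¬Fin0 (subst Fin (lde-noLeft H dH) i))
leftWins-≽ G H (mk _ f _ _) dG dH G≽H (moveʳ j ¬w) =
  Win+⇒Wins (moveʳ j (¬w ∘ rightWins-≽ G H (f j) dG dH G≽H ∘ Wins⇒Win+))
rightWins-≽ (mk _ _ _ _) H X dG dH G≽H (noMove zG zX) = Win+⇒Wins (noMove (proj₁ G≽H zG) zX)
rightWins-≽ G@(mk _ _ _ g) H X dG dH G≽H (moveˡ i ¬w) with proj₂ G≽H i
... | j , gᵢ≽Hⱼ = Win+⇒Wins (moveˡ j
  (¬w ∘ leftWins-≽ (g i) (opt Right H j) X (lde-right G dG i) (lde-right H dH j) gᵢ≽Hⱼ ∘ Wins⇒Win+))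
rightWins-≽ G@(mk _ _ _ _) H (mk _ _ _ k) dG dH G≽H (moveʳ j ¬w) =
  Win+⇒Wins (moveʳ j (¬w ∘ leftWins-≽ G H (k j) dG dH G≽H ∘ Wins⇒Win+))

≽⇒⊒ : ∀ {G H} → IsLeftDeadEnd G → IsLeftDeadEnd H → G ≽ H → G ⊒ H
≽⇒⊒ {G} {H} dG dH G≽H = ⊒-intro λ X →
  leftWins-≽ G H X dG dH G≽H ∘ Wins⇒Win+ , rightWins-≽ G H X dG dH G≽H ∘ Wins⇒Win+

-- Dead-ending games and races

data IsRightDeadEnd (G : Game) : Set where
  rightDeadEnd : #opts Right G ≡ 0 → (∀ i → IsRightDeadEnd (opt Left G i)) → IsRightDeadEnd G

data IsDeadEnding (G : Game) : Set where
  deadEnding : (#opts Left G ≡ 0 → IsLeftDeadEnd G) → (#opts Right G ≡ 0 → IsRightDeadEnd G) →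
               (∀ p i → IsDeadEnding (opt p G i)) → IsDeadEnding G

rde-+ : ∀ {G H} → IsRightDeadEnd G → IsRightDeadEnd H → IsRightDeadEnd (G + H)
rde-+ {G} {H} dG@(rightDeadEnd zG dsG) dH@(rightDeadEnd zH dsH) =
  rightDeadEnd (trans (#opts-+ Right G H) (cong₂ _+ℕ_ zG zH)) λ x →
    [ (λ (i , eq) → subst IsRightDeadEnd (sym eq) (rde-+ (dsG i) dH))
    , (λ (j , eq) → subst IsRightDeadEnd (sym eq) (rde-+ dG (dsH j))) ]′ (opt-+-split Left G H x)

lde⇒de : ∀ G → IsLeftDeadEnd G → IsDeadEnding G
lde⇒de (mk _ _ _ g) dG@(refl , dsG) = deadEnding (λ _ → dG) (λ z → rightDeadEnd z (λ ()))
  λ { Left () ; Right j → lde⇒de (g j) (dsG j) }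

de-+ : ∀ {G H} → IsDeadEnding G → IsDeadEnding H → IsDeadEnding (G + H)
de-+ {G} {H} dG@(deadEnding lG rG dsG) dH@(deadEnding lH rH dsH) = deadEnding
  (λ z → let z′ = trans (sym (#opts-+ Left G H)) z in
         lde-+ G H (lG (m+n≡0⇒m≡0 _ z′)) (lH (m+n≡0⇒n≡0 (#opts Left G) z′)))
  (λ z → let z′ = trans (sym (#opts-+ Right G H)) z in
         rde-+ (rG (m+n≡0⇒m≡0 _ z′)) (rH (m+n≡0⇒n≡0 (#opts Right G) z′)))
  λ p x → [ (λ (i , eq) → subst IsDeadEnding (sym eq) (de-+ (dsG p i) dH))
          , (λ (j , eq) → subst IsDeadEnding (sym eq) (de-+ dG (dsH p j))) ]′ (opt-+-split p G H x)

EndsWithin : Player → ℕ → Game → Set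
EndsWithin p zero    G = #opts p G ≡ 0
EndsWithin p (suc n) G = #opts p G ≡ 0 ⊎ ∃[ i ] EndsWithin p n (opt p G i)

LastsFor : Player → ℕ → Game → Set
LastsFor p zero    G = ⊤
LastsFor p (suc n) G = ¬ #opts p G ≡ 0 × ∀ i → LastsFor p n (opt p G i)

LastsFor-≤ : ∀ {p m n G} → m ≤ n → LastsFor p n G → LastsFor p m G
LastsFor-≤ z≤n       _         = tt
LastsFor-≤ (s≤s m≤n) (nz , ls) = nz , λ i → LastsFor-≤ m≤n (ls i)

LastsFor-+ʳ : ∀ {p} n G K → LastsFor p n K → LastsFor p n (G + K)
LastsFor-+ʳ     zero    G K _         = tt
LastsFor-+ʳ {p} (suc n) G K (nz , ls) = nz ∘ m+n≡0⇒n≡0 (#opts p G) ∘ trans (sym (#opts-+ p G K)) , λ x →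
  [ (λ (i , eq) → subst (LastsFor p n) (sym eq) (LastsFor-+ʳ n (opt p G i) K (LastsFor-≤ (n≤1+n n) (nz , ls))))
  , (λ (j , eq) → subst (LastsFor p n) (sym eq) (LastsFor-+ʳ n G (opt p K j) (ls j))) ]′ (opt-+-split p G K x)

argmin : ∀ {n} (f : Fin (suc n) → ℕ) → ∃[ i ] ∀ j → f i ≤ f j
argmin {zero}  f = zero , λ { zero → ≤-refl }
argmin {suc n} f with argmin (f ∘ suc)
... | i , min with f zero ≤? f (suc i)
...   | yes f₀≤ = zero , λ { zero → ≤-refl ; (suc j) → ≤-trans f₀≤ (min j) }
...   | no  f₀≰ = suc i , λ { zero → <⇒≤ (≰⇒> f₀≰) ; (suc j) → min j }

shortestRightRun : ∀ K → ∃[ n ] EndsWithin Right n K × LastsFor Right n K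
shortestRightRun (mk _ _ zero    _) = zero , refl , tt
shortestRightRun (mk _ _ (suc b) g) =
  suc (runLength j*) , inj₂ (j* , proj₁ (run j*)) , (λ ()) , λ j → LastsFor-≤ (shortest j) (proj₂ (run j))
  where
  runLength : Fin (suc b) → ℕ
  runLength j = proj₁ (shortestRightRun (g j))
  run : ∀ j → EndsWithin Right (runLength j) (g j) × LastsFor Right (runLength j) (g j)
  run j = proj₂ (shortestRightRun (g j))
  j* = proj₁ (argmin runLength)
  shortest = proj₂ (argmin runLength)

rightWins-race : ∀ n P Q → IsLeftDeadEnd P → IsRightDeadEnd Q →
                 EndsWithin Right n P → LastsFor Left n Q → Wins Right (P + Q)
rightWins-race zero    P Q _ (rightDeadEnd zQ _) zP _ = Win+⇒Wins (noMove zP zQ)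
rightWins-race (suc n) P Q _ (rightDeadEnd zQ _) (inj₁ zP) _ = Win+⇒Wins (noMove zP zQ)
rightWins-race (suc n) P@(mk _ _ _ g) Q dP (rightDeadEnd _ dsQ) (inj₂ (j , ends)) (nz , lasts) =
  Win+⇒Wins (moveˡ j (leftLoses ∘ Wins⇒Win+))
  where
  leftLoses : ¬ Win+ Left (g j) Q
  leftLoses (noMove _ zQ) = nz zQ
  leftLoses (moveˡ i _)   = ¬Fin0 (subst Fin (lde-noLeft (g j) (lde-right P dP j)) i)
  leftLoses (moveʳ i ¬w)  = ¬w (rightWins-race n (g j) (opt Left Q i) (lde-right P dP j) (dsQ i) ends (lasts i))

leftWins-race : ∀ n P Q → IsLeftDeadEnd P → IsRightDeadEnd Q →
                EndsWithin Left n Q → LastsFor Right n P → Wins Left (P + Q)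
leftWins-race zero    P Q dP _ zQ _ = Win+⇒Wins (noMove (lde-noLeft P dP) zQ)
leftWins-race (suc n) P Q dP _ (inj₁ zQ) _ = Win+⇒Wins (noMove (lde-noLeft P dP) zQ)
leftWins-race (suc n) P Q@(mk _ f _ _) dP (rightDeadEnd _ dsQ) (inj₂ (i , ends)) (nz , lasts) =
  Win+⇒Wins (moveʳ i (rightLoses ∘ Wins⇒Win+))
  where
  rightLoses : ¬ Win+ Right P (f i)
  rightLoses (noMove zP _) = nz zP
  rightLoses (moveˡ j ¬w)  = ¬w (leftWins-race n (opt Right P j) (f i) (lde-right P dP j) (dsQ i) ends (lasts j))
  rightLoses (moveʳ j _)   with dsQ i
  ... | rightDeadEnd z _ = ¬Fin0 (subst Fin z j)

integer : ℕ → Game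
integer zero    = zeroG
integer (suc n) = mk 1 (λ _ → integer n) 0 (λ ())

integer-rde : ∀ n → IsRightDeadEnd (integer n)
integer-rde zero    = rightDeadEnd refl (λ ())
integer-rde (suc n) = rightDeadEnd refl (λ _ → integer-rde n)

integer-de : ∀ n → IsDeadEnding (integer n)
integer-de zero    = lde⇒de zeroG lde-zero
integer-de (suc n) = deadEnding (λ ()) (λ _ → integer-rde (suc n)) λ { Left _ → integer-de n ; Right () }

integer-lastsFor : ∀ n → LastsFor Left n (integer n)
integer-lastsFor zero    = tt
integer-lastsFor (suc n) = (λ ()) , λ _ → integer-lastsFor n

infix 8 −_

−_ : Game → Game
− mk a f b g = mk b (λ j → − g j) a (λ i → − f i)

−-rde : ∀ K → IsLeftDeadEnd K → IsRightDeadEnd (− K)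
−-rde (mk _ _ _ g) (refl , ds) = rightDeadEnd refl λ j → −-rde (g j) (ds j)

−-endsWithin : ∀ n K → EndsWithin Right n K → EndsWithin Left n (− K)
−-endsWithin zero    (mk _ _ _ _) z              = z
−-endsWithin (suc n) (mk _ _ _ _) (inj₁ z)       = inj₁ z
−-endsWithin (suc n) (mk _ _ _ g) (inj₂ (j , e)) = inj₂ (j , −-endsWithin n (g j) e)

−-lastsFor : ∀ n K → LastsFor Right n K → LastsFor Left n (− K)
−-lastsFor zero    (mk _ _ _ _) _         = tt
−-lastsFor (suc n) (mk _ _ _ g) (nz , ls) = nz , λ j → −-lastsFor n (g j) (ls j)

-- Cancellation of Left dead ends

leftWins-inverse⁺  : ∀ Y K → IsDeadEnding Y → IsLeftDeadEnd K → Win Left Y → Wins Left ((Y + K) + − K)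
leftWins-inverse⁻  : ∀ Y K → IsDeadEnding Y → IsLeftDeadEnd K → Win+ Left (Y + K) (− K) → Wins Left Y
rightWins-inverse⁺ : ∀ Y K → IsDeadEnding Y → IsLeftDeadEnd K → Win Right Y → Wins Right ((Y + K) + − K)
rightWins-inverse⁻ : ∀ Y K → IsDeadEnding Y → IsLeftDeadEnd K → Win+ Right (Y + K) (− K) → Wins Right Y

leftWins-inverse⁺ Y K (deadEnding lY _ _) dK (noMove zY) =
  let n , ends , lasts = shortestRightRun K in
  leftWins-race n (Y + K) (− K) (lde-+ Y K (lY zY) dK) (−-rde K dK) (−-endsWithin n K ends) (LastsFor-+ʳ n Y K lasts)
leftWins-inverse⁺ Y K (deadEnding _ _ dsY) dK (move i ¬w) =
  Wins-moveˡˡ Y K (− K) i (¬w ∘ rightWins-inverse⁻ (opt Left Y i) K (dsY Left i) dK ∘ Wins⇒Win+)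

leftWins-inverse⁻ Y K _ _ (noMove z _) =
  Win⇒Wins (noMove (m+n≡0⇒m≡0 _ (trans (sym (#opts-+ Left Y K)) z)))
leftWins-inverse⁻ Y K (deadEnding _ _ dsY) dK (moveˡ x ¬w) =
  [ (λ (i , eq) → Win⇒Wins (move i (¬w ∘ subst (λ A → Wins Right (A + − K)) (sym eq)
                                       ∘ rightWins-inverse⁺ (opt Left Y i) K (dsY Left i) dK ∘ Wins⇒Win)))
  , (λ (j , _) → ⊥-elim (¬Fin0 (subst Fin (lde-noLeft K dK) j))) ]′ (opt-+-split Left Y K x)
leftWins-inverse⁻ Y K@(mk _ _ _ g) dY dK (moveʳ j ¬w) = decidable-stable (wins? Left Y) λ ¬wY →
  ¬w (Wins-moveˡʳ Y K (− g j) j (¬wY ∘ leftWins-inverse⁻ Y (g j) dY (lde-right K dK j) ∘ Wins⇒Win+))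

rightWins-inverse⁺ Y K (deadEnding _ rY _) dK (noMove zY) =
  let n , ends , lasts = shortestRightRun K in
  ≅-wins (+-cong-≅ (+-comm-≅ K Y) ≅-refl) (≅-wins (≅-sym (+-assoc-≅ K Y (− K)))
    (rightWins-race n K (Y + − K) dK (rde-+ (rY zY) (−-rde K dK)) ends
      (LastsFor-+ʳ n Y (− K) (−-lastsFor n K lasts))))
rightWins-inverse⁺ Y K (deadEnding _ _ dsY) dK (move j ¬w) =
  Wins-moveˡˡ Y K (− K) j (¬w ∘ leftWins-inverse⁻ (opt Right Y j) K (dsY Right j) dK ∘ Wins⇒Win+)

rightWins-inverse⁻ Y K _ _ (noMove z _) =
  Win⇒Wins (noMove (m+n≡0⇒m≡0 _ (trans (sym (#opts-+ Right Y K)) z)))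
rightWins-inverse⁻ Y K@(mk _ _ _ g) dY@(deadEnding _ _ dsY) dK (moveˡ x ¬w) =
  [ (λ (j , eq) → Win⇒Wins (move j (¬w ∘ subst (λ A → Wins Left (A + − K)) (sym eq)
                                       ∘ leftWins-inverse⁺ (opt Right Y j) K (dsY Right j) dK ∘ Wins⇒Win)))
  , (λ (j , eq) → decidable-stable (wins? Right Y) λ ¬wY →
       ¬w (subst (λ A → Wins Left (A + − K)) (sym eq)
             (Win+⇒Wins (moveʳ j (¬wY ∘ rightWins-inverse⁻ Y (g j) dY (lde-right K dK j) ∘ Wins⇒Win+))))) ]′
  (opt-+-split Right Y K x)
rightWins-inverse⁻ Y K@(mk _ _ _ _) _ dK (moveʳ j _) = ⊥-elim (¬Fin0 (subst Fin (lde-noLeft K dK) j))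

record Distinguisher (G H : Game) : Set where
  field
    game         : Game
    isDeadEnding : IsDeadEnding game
    rightWins    : Wins Right (G + game)
    rightLoses   : ¬ Wins Right (H + game)

¬≽-cases : ∀ G H → ¬ G ≽ H →
  (#opts Right G ≡ 0 × ¬ #opts Right H ≡ 0) ⊎ (∃[ i ] ∀ j → ¬ opt Right G i ≽ opt Right H j)
¬≽-cases (mk _ _ b g) H ¬G≽H with b ≟ 0 →-dec #opts Right H ≟ 0
... | no ¬ends = inj₁ (decidable-stable (b ≟ 0) (λ nzG → ¬ends (⊥-elim ∘ nzG)) , λ zH → ¬ends (λ _ → zH))
... | yes ends =
  let i , ¬∃ = ¬∀⟶∃¬ _ _ (λ i → any? (λ j → g i ≽? opt Right H j)) (λ all → ¬G≽H (ends , all)) in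
  inj₂ (i , λ j gᵢ≽Hⱼ → ¬∃ (j , gᵢ≽Hⱼ))

distinguisher-ends : ∀ G H → IsLeftDeadEnd H → #opts Right G ≡ 0 → ¬ #opts Right H ≡ 0 → Distinguisher G H
distinguisher-ends G H dH zG nzH = record
  { game = zeroG ; isDeadEnding = lde⇒de zeroG lde-zero
  ; rightWins = Win+⇒Wins (noMove zG refl) ; rightLoses = rightLoses ∘ Wins⇒Win+ }
  where
  rightLoses : ¬ Win+ Right H zeroG
  rightLoses (noMove zH _) = nzH zH
  rightLoses (moveˡ j ¬w)  = ¬w (leftWins-+zero (opt Right H j) (lde-right H dH j))

-- D = { n, D₀, D₁, … ∣ 0 }, with n the length of a shortest Right run in Gᵢ and Dⱼ separating
-- Gᵢ from Hⱼ: after Right's move to Gᵢ + D, each Left move loses (a lost race, or some Gᵢ + Dⱼ),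
-- while Right's move to Hⱼ + D is answered by Hⱼ + Dⱼ, and at H + 0 Left has no move and wins.
distinguisher-option : ∀ G H i → IsLeftDeadEnd G → IsLeftDeadEnd H →
  (∀ j → Distinguisher (opt Right G i) (opt Right H j)) → Distinguisher G H
distinguisher-option G H i dG dH Dⱼ = record
  { game = D ; isDeadEnding = deadEnding (λ ()) (λ ()) D-options
  ; rightWins = Win+⇒Wins (moveˡ i (leftLoses ∘ Wins⇒Win+)) ; rightLoses = rightLoses ∘ Wins⇒Win+ }
  where
  Gᵢ = opt Right G i
  dGᵢ = lde-right G dG i
  n = proj₁ (shortestRightRun Gᵢ)
  D : Game
  D = mk (suc (#opts Right H)) (λ { zero → integer n ; (suc j) → Distinguisher.game (Dⱼ j) }) 1 (λ _ → zeroG)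
  D-options : ∀ p x → IsDeadEnding (opt p D x)
  D-options Left  zero    = integer-de n
  D-options Left  (suc j) = Distinguisher.isDeadEnding (Dⱼ j)
  D-options Right _       = lde⇒de zeroG lde-zero
  leftLoses : ¬ Win+ Left Gᵢ D
  leftLoses (moveˡ x _)        = ¬Fin0 (subst Fin (lde-noLeft Gᵢ dGᵢ) x)
  leftLoses (moveʳ zero ¬w)    =
    ¬w (rightWins-race n Gᵢ (integer n) dGᵢ (integer-rde n)
          (proj₁ (proj₂ (shortestRightRun Gᵢ))) (integer-lastsFor n))
  leftLoses (moveʳ (suc j) ¬w) = ¬w (Distinguisher.rightWins (Dⱼ j))
  rightLoses : ¬ Win+ Right H D
  rightLoses (moveˡ j ¬w)    = ¬w (Win+⇒Wins (moveʳ (suc j) (Distinguisher.rightLoses (Dⱼ j))))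
  rightLoses (moveʳ zero ¬w) = ¬w (leftWins-+zero H dH)

distinguisher : ∀ G H → IsLeftDeadEnd G → IsLeftDeadEnd H → ¬ G ≽ H → Distinguisher G H
distinguisher G@(mk _ _ _ g) H dG dH ¬G≽H with ¬≽-cases G H ¬G≽H
... | inj₁ (zG , nzH) = distinguisher-ends G H dH zG nzH
... | inj₂ (i , ¬≽)   = distinguisher-option G H i dG dH
  (λ j → distinguisher (g i) (opt Right H j) (lde-right G dG i) (lde-right H dH j) (¬≽ j))

distinguisher⇒¬⊒-+ : ∀ {G H} K → IsLeftDeadEnd G → IsLeftDeadEnd H → IsLeftDeadEnd K →
                      Distinguisher G H → ¬ G + K ⊒ H + K
distinguisher⇒¬⊒-+ {G} {H} K dG dH dK D G+K⊒H+K =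
  rightLoses (rightWins-inverse⁻ (H + game) K (de-+ (lde⇒de H dH) isDeadEnding) dK
    (Wins⇒Win+ (≈-rightWins (rearrange H) rightWins-H+K)))
  where
  open Distinguisher D
  rearrange : ∀ X → (X + K) + (game + − K) ≈ ((X + game) + K) + − K
  rearrange X = solve 4 (λ x k t n → (x ⊕ k) ⊕ (t ⊕ n) ⊜ ((x ⊕ t) ⊕ k) ⊕ n) ≈-refl X K game (− K)
  rightWins-G+K : Wins Right ((G + K) + (game + − K))
  rightWins-G+K = ≈-rightWins (≈-sym (rearrange G))
    (rightWins-inverse⁺ (G + game) K (de-+ (lde⇒de G dG) isDeadEnding) dK (Wins⇒Win rightWins))
  rightWins-H+K : Wins Right ((H + K) + (game + − K))
  rightWins-H+K = proj₂ (⊒-elim G+K⊒H+K (game + − K)) rightWins-G+K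

+-cancelʳ-≽ : ∀ G H K → IsLeftDeadEnd G → IsLeftDeadEnd H → IsLeftDeadEnd K → G + K ⊒ H + K → G ≽ H
+-cancelʳ-≽ G H K dG dH dK G+K⊒H+K =
  decidable-stable (G ≽? H) λ ¬G≽H → distinguisher⇒¬⊒-+ K dG dH dK (distinguisher G H dG dH ¬G≽H) G+K⊒H+K

⊒⇒≽ : ∀ G H → IsLeftDeadEnd G → IsLeftDeadEnd H → G ⊒ H → G ≽ H
⊒⇒≽ G H dG dH G⊒H = +-cancelʳ-≽ G H zeroG dG dH lde-zero (⊒-+ʳ zeroG G⊒H)

+-cancelʳ : ∀ {G H} K → IsLeftDeadEnd G → IsLeftDeadEnd H → IsLeftDeadEnd K → G + K ≈ H + K → G ≈ H
+-cancelʳ {G} {H} K dG dH dK G+K≈H+K = ⊒-antisym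
  (≽⇒⊒ dG dH (+-cancelʳ-≽ G H K dG dH dK (≈⇒⊒ G+K≈H+K)))
  (≽⇒⊒ dH dG (+-cancelʳ-≽ H G K dH dG dK (≈⇒⊑ G+K≈H+K)))

+-cancelˡ : ∀ {G H} K → IsLeftDeadEnd G → IsLeftDeadEnd H → IsLeftDeadEnd K → K + G ≈ K + H → G ≈ H
+-cancelˡ {G} {H} K dG dH dK K+G≈K+H =
  +-cancelʳ K dG dH dK (≈-trans (+-comm-≈ G K) (≈-trans K+G≈K+H (+-comm-≈ K H)))

≈zero⇒noRight : ∀ G → IsLeftDeadEnd G → G ≈ zeroG → #opts Right G ≡ 0
≈zero⇒noRight G@(mk _ _ _ _) dG G≈0 =
  Fin→Fin0⇒≡0 (λ i → proj₁ (proj₂ (⊒⇒≽ G zeroG dG lde-zero (≈⇒⊒ G≈0)) i)) refl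

noRight⇒≈zero : ∀ G → IsLeftDeadEnd G → #opts Right G ≡ 0 → G ≈ zeroG
noRight⇒≈zero (mk _ _ _ _) (refl , _) refl = ≅⇒≈ (bisim (λ { Left () ; Right () }) (λ { Left () ; Right () }))

+-conicalˡ : ∀ G H → IsLeftDeadEnd G → IsLeftDeadEnd H → G + H ≈ zeroG → G ≈ zeroG
+-conicalˡ G H dG dH G+H≈0 = noRight⇒≈zero G dG
  (m+n≡0⇒m≡0 _ (trans (sym (#opts-+ Right G H)) (≈zero⇒noRight (G + H) (lde-+ G H dG dH) G+H≈0)))

goodOption⇒≈rightOption : ∀ S T O → IsLeftDeadEnd S → IsLeftDeadEnd T → S ≈ T → IsGoodOption O S →
                          ∃[ j ] O ≈ opt Right T j
goodOption⇒≈rightOption (mk _ _ _ _) T O (refl , _) _ _ (inj₁ (() , _) , _)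
goodOption⇒≈rightOption S@(mk _ _ _ g) T@(mk _ _ _ k) O dS@(refl , dsS) dT@(refl , dsT) S≈T (inj₂ (i , refl) , good) =
  j , ⊒-antisym (≽⇒⊒ (dsS i) (dsT j) gᵢ≽kⱼ) (≽⇒⊒ (dsT j) (dsS i) (≽-trans (k j) (g i′) (g i) kⱼ≽gᵢ′ gᵢ′≽gᵢ))
  where
  S≽T : S ≽ T
  S≽T = ⊒⇒≽ S T dS dT (≈⇒⊒ S≈T)
  T≽S : T ≽ S
  T≽S = ⊒⇒≽ T S dT dS (≈⇒⊑ S≈T)
  j = proj₁ (proj₂ S≽T i)
  gᵢ≽kⱼ = proj₂ (proj₂ S≽T i)
  i′ = proj₁ (proj₂ T≽S j)
  kⱼ≽gᵢ′ = proj₂ (proj₂ T≽S j)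
  -- gᵢ ≽ gᵢ′ through kⱼ, and goodness of gᵢ rules out gᵢ > gᵢ′.
  gᵢ′≽gᵢ : g i′ ≽ g i
  gᵢ′≽gᵢ = decidable-stable (g i′ ≽? g i) λ ¬≽ → good (g i′) (inj₂ (i′ , refl))
    ( _⊒_.toGe (≽⇒⊒ (dsS i) (dsS i′) (≽-trans (g i) (k j) (g i′) gᵢ≽kⱼ kⱼ≽gᵢ′))
    , λ gᵢ≡gᵢ′ → ¬≽ (⊒⇒≽ (g i′) (g i) (dsS i′) (dsS i) (fromGe (proj₂ gᵢ≡gᵢ′))))

-- Atoms, primes and factorisations

∑ : List Game → Game
∑ = foldr _+_ zeroG

sumG≈∑ : ∀ Gs → sumG Gs ≈ ∑ Gs
sumG≈∑ []               = ≈-refl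
sumG≈∑ (G ∷ [])         = ≈-sym (+-identityʳ G)
sumG≈∑ (G ∷ Gs@(_ ∷ _)) = +-congˡ (sumG≈∑ Gs)

lde-sumG : ∀ {Gs} → All IsLeftDeadEnd Gs → IsLeftDeadEnd (sumG Gs)
lde-sumG []                 = lde-zero
lde-sumG (dG ∷ [])          = dG
lde-sumG (dG ∷ dGs@(_ ∷ _)) = lde-+ _ _ dG (lde-sumG dGs)

lde-∑ : ∀ {Gs} → All IsLeftDeadEnd Gs → IsLeftDeadEnd (∑ Gs)
lde-∑ []         = lde-zero
lde-∑ (dG ∷ dGs) = lde-+ _ _ dG (lde-∑ dGs)

atoms-lde : ∀ {Gs} → All IsAtom Gs → IsLeftDeadEnd (∑ Gs)
atoms-lde = lde-∑ ∘ All.map proj₁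

open import Data.List.Relation.Binary.Permutation.Setoid ≈-setoid as ↭≈ using () renaming (_↭_ to _↭≈_)
open import Data.List.Relation.Binary.Permutation.Setoid.Properties ≈-setoid
  using (foldr-commMonoid; drop-∷; xs↭ys⇒|xs|≡|ys|)

∑-↭ : ∀ {Gs Hs} → Gs ↭≈ Hs → ∑ Gs ≈ ∑ Hs
∑-↭ = foldr-commMonoid +-isCommutativeMonoid

↭⇒↭≈ : ∀ {Gs Hs} → Gs ↭ Hs → Gs ↭≈ Hs
↭⇒↭≈ = ↭.↭⇒↭ₛ′ (Setoid.isEquivalence ≈-setoid)

Pointwise-↭⇒↭-Pointwise : ∀ {A : Set} {R : A → A → Set} {As Ms Cs} → Pointwise R As Ms → Ms ↭ Cs →
                           ∃[ As′ ] As ↭ As′ × Pointwise R As′ Cs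
Pointwise-↭⇒↭-Pointwise {As = As} pw ↭.refl = As , ↭.refl , pw
Pointwise-↭⇒↭-Pointwise {As = A ∷ _} (r ∷ pw) (↭.prep _ p) =
  let As′ , q , pw′ = Pointwise-↭⇒↭-Pointwise pw p in A ∷ As′ , ↭.prep A q , r ∷ pw′
Pointwise-↭⇒↭-Pointwise {As = A ∷ A′ ∷ _} (r ∷ r′ ∷ pw) (↭.swap _ _ p) =
  let As′ , q , pw′ = Pointwise-↭⇒↭-Pointwise pw p in A′ ∷ A ∷ As′ , ↭.swap A A′ q , r′ ∷ r ∷ pw′
Pointwise-↭⇒↭-Pointwise pw (↭.trans p q) =
  let As′ , p′ , pw′ = Pointwise-↭⇒↭-Pointwise pw p ; As″ , q′ , pw″ = Pointwise-↭⇒↭-Pointwise pw′ q in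
  As″ , ↭.trans p′ q′ , pw″

↭≈⇒↭-Pointwise : ∀ {As Bs} → As ↭≈ Bs → ∃[ Cs ] As ↭ Cs × Pointwise _≈_ Cs Bs
↭≈⇒↭-Pointwise {As} (↭≈.refl pw) = As , ↭.refl , pw
↭≈⇒↭-Pointwise {A ∷ _} (↭≈.prep A≈B p) =
  let Cs , q , pw = ↭≈⇒↭-Pointwise p in A ∷ Cs , ↭.prep A q , A≈B ∷ pw
↭≈⇒↭-Pointwise {A ∷ A′ ∷ _} (↭≈.swap A≈B A′≈B′ p) =
  let Cs , q , pw = ↭≈⇒↭-Pointwise p in A′ ∷ A ∷ Cs , ↭.swap A A′ q , A′≈B′ ∷ A≈B ∷ pw
↭≈⇒↭-Pointwise (↭≈.trans p q) =
  let Cs , p′ , pw = ↭≈⇒↭-Pointwise p ; Ds , q′ , pw′ = ↭≈⇒↭-Pointwise q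
      Es , q″ , pw″ = Pointwise-↭⇒↭-Pointwise pw q′ in
  Es , ↭.trans p′ q″ , Pointwise.transitive ≈-trans pw″ pw′

↭≈⇒SameFactorisation : ∀ {As Bs} → As ↭≈ Bs → SameFactorisation As Bs
↭≈⇒SameFactorisation As↭Bs =
  let Cs , As↭Cs , Cs≋Bs = ↭≈⇒↭-Pointwise As↭Bs in Cs , As↭Cs , Pointwise.map _≈_.toEq Cs≋Bs

rightOption-∑ : ∀ Cs j → ∃₂ λ B Rest → Cs ↭ B ∷ Rest × ∃[ k ] opt Right (∑ Cs) j ≈ opt Right B k + ∑ Rest
rightOption-∑ (C ∷ Cs) x with opt-+-split Right C (∑ Cs) x
... | inj₁ (k , eq) = C , Cs , ↭.refl , k , ≡⇒≈ eq
... | inj₂ (j , eq) =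
  let B , Rest , p , k , e = rightOption-∑ Cs j in
  B , C ∷ Rest , ↭.trans (↭.prep C p) (↭.swap C B ↭.refl) , k ,
  ≈-trans (≡⇒≈ eq) (≈-trans (+-congˡ e)
    (solve 3 (λ c b r → c ⊕ (b ⊕ r) ⊜ b ⊕ (c ⊕ r)) ≈-refl C (opt Right B k) (∑ Rest)))

atom≉zero : ∀ {A} → IsAtom A → ¬ A ≈ zeroG
atom≉zero (_ , A≢0 , _) (fromEq A≡0) = A≢0 A≡0

atom-+≈atom⇒≈zero : ∀ {A B Z} → IsAtom A → IsAtom B → IsLeftDeadEnd Z → A + Z ≈ B → Z ≈ zeroG
atom-+≈atom⇒≈zero aA (_ , _ , irreducible) dZ A+Z≈B with irreducible _ _ (proj₁ aA) dZ (_≈_.toEq (≈-sym A+Z≈B))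
... | inj₁ A≡0 = ⊥-elim (atom≉zero aA (fromEq A≡0))
... | inj₂ Z≡0 = fromEq Z≡0

∣-intro : ∀ {P X} Y → IsLeftDeadEnd Y → X ≈ P + Y → P ∣g X
∣-intro Y dY X≈P+Y = Y , dY , _≈_.toEq X≈P+Y

¬prime∣zero : ∀ {P} → IsPrime P → ¬ P ∣g zeroG
¬prime∣zero {P} (dP , P≢0 , _) (Y , dY , 0≡P+Y) = P≢0 (_≈_.toEq (+-conicalˡ P Y dP dY (≈-sym (fromEq 0≡P+Y))))

prime∣atom⇒≈ : ∀ {P C} → IsPrime P → IsAtom C → P ∣g C → C ≈ P
prime∣atom⇒≈ {P} (dP , P≢0 , _) (_ , _ , irreducible) (Y , dY , C≡P+Y) with irreducible P Y dP dY C≡P+Y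
... | inj₁ P≡0 = ⊥-elim (P≢0 P≡0)
... | inj₂ Y≡0 = ≈-trans (fromEq C≡P+Y) (≈-trans (+-congˡ (fromEq Y≡0)) (+-identityʳ P))

prime∣∑atoms : ∀ {P} Cs → IsPrime P → All IsAtom Cs → P ∣g ∑ Cs →
               ∃₂ λ C Cs′ → All IsAtom (C ∷ Cs′) × C ≈ P × Cs ↭≈ C ∷ Cs′
prime∣∑atoms []       pP _ P∣0 = ⊥-elim (¬prime∣zero pP P∣0)
prime∣∑atoms (C ∷ Cs) pP@(_ , _ , prime) aCs@(aC ∷ aCs′) P∣C+∑Cs
  with prime C (∑ Cs) (proj₁ aC) (atoms-lde aCs′) P∣C+∑Cs
... | inj₁ P∣C   = C , Cs , aCs , prime∣atom⇒≈ pP aC P∣C , ↭≈.↭-refl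
... | inj₂ P∣∑Cs with prime∣∑atoms Cs pP aCs′ P∣∑Cs
...   | D , Cs″ , aD ∷ aCs″ , D≈P , Cs↭ =
  D , C ∷ Cs″ , aD ∷ aC ∷ aCs″ , D≈P , ↭≈.↭-trans (↭≈.↭-prep C Cs↭) (↭≈.↭-swap C D ↭≈.↭-refl)

FactorisesUniquely : List Game → Set
FactorisesUniquely Gs = ∀ Hs → All IsAtom Hs → ∑ Gs ≈ ∑ Hs → Gs ↭≈ Hs

[]-factorisesUniquely : FactorisesUniquely []
[]-factorisesUniquely []       _          _     = ↭≈.↭-refl
[]-factorisesUniquely (H ∷ Hs) (aH ∷ aHs) 0≈∑Hs =
  ⊥-elim (atom≉zero aH (+-conicalˡ H (∑ Hs) (proj₁ aH) (atoms-lde aHs) (≈-sym 0≈∑Hs)))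

factorisesUniquely-drop : ∀ {Gs D Gs′} → FactorisesUniquely Gs → Gs ↭≈ D ∷ Gs′ → IsAtom D → FactorisesUniquely Gs′
factorisesUniquely-drop {D = D} unique Gs↭ aD Hs aHs ∑Gs′≈∑Hs =
  drop-∷ (↭≈.↭-trans (↭≈.↭-sym Gs↭) (unique (D ∷ Hs) (aD ∷ aHs) (≈-trans (∑-↭ Gs↭) (+-congˡ ∑Gs′≈∑Hs))))

module _ {A B : Game} (aA : IsAtom A) (aB : IsAtom B) where

  private
    dA = proj₁ aA
    dB = proj₁ aB

  -- A + ∑Hs = B + ∑Rest plays the role of ∑Cs, and ∑Ps + ∑Hs = Z + ∑Rest that of its good option.
  Exchange : List Game → List Game → Set
  Exchange Ps Hs = ∀ {Rest Z} → All IsPrime Ps → FactorisesUniquely Hs → All IsAtom Hs → All IsAtom Rest →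
    IsLeftDeadEnd Z → A + ∑ Hs ≈ B + ∑ Rest → ∑ Ps + ∑ Hs ≈ Z + ∑ Rest → A ∷ Hs ↭≈ B ∷ Rest

  exchange-[] : ∀ Hs → Exchange [] Hs
  exchange-[] Hs {Rest} {Z} [] unique _ aRest dZ A+H≈B+R 0+H≈Z+R = ↭≈.prep A≈B (unique Rest aRest H≈R)
    where
    open SetoidReasoning ≈-setoid
    H = ∑ Hs
    R = ∑ Rest
    H≈Z+R : H ≈ Z + R
    H≈Z+R = ≈-trans (≈-sym (+-identityˡ H)) 0+H≈Z+R
    A+Z≈B : A + Z ≈ B
    A+Z≈B = +-cancelʳ R (lde-+ A Z dA dZ) dB (atoms-lde aRest) (begin
      (A + Z) + R ≈⟨ +-assoc A Z R ⟩
      A + (Z + R) ≈⟨ +-congˡ H≈Z+R ⟨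
      A + H       ≈⟨ A+H≈B+R ⟩
      B + R       ∎)
    Z≈0 : Z ≈ zeroG
    Z≈0 = atom-+≈atom⇒≈zero aA aB dZ A+Z≈B
    A≈B : A ≈ B
    A≈B = begin
      A         ≈⟨ +-identityʳ A ⟨
      A + zeroG ≈⟨ +-congˡ Z≈0 ⟨
      A + Z     ≈⟨ A+Z≈B ⟩
      B         ∎
    H≈R : H ≈ R
    H≈R = begin
      H         ≈⟨ H≈Z+R ⟩
      Z + R     ≈⟨ +-congʳ Z≈0 ⟩
      zeroG + R ≈⟨ +-identityˡ R ⟩
      R         ∎

  exchange-∣Z : ∀ {P Ps Hs Rest Z Z′} → IsPrime P → Exchange Ps Hs →
    All IsPrime Ps → FactorisesUniquely Hs → All IsAtom Hs → All IsAtom Rest → IsLeftDeadEnd Z′ →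
    A + ∑ Hs ≈ B + ∑ Rest → (P + ∑ Ps) + ∑ Hs ≈ Z + ∑ Rest → Z ≈ P + Z′ → A ∷ Hs ↭≈ B ∷ Rest
  exchange-∣Z {P} {Ps} {Hs} {Rest} {Z} {Z′} (dP , _) IH pPs unique aHs aRest dZ′ A+H≈B+R P+S+H≈Z+R Z≈P+Z′ =
    IH pPs unique aHs aRest dZ′ A+H≈B+R
      (+-cancelˡ P (lde-+ S H (lde-∑ (All.map proj₁ pPs)) (atoms-lde aHs)) (lde-+ Z′ R dZ′ (atoms-lde aRest)) dP (begin
        P + (S + H)  ≈⟨ +-assoc P S H ⟨
        (P + S) + H  ≈⟨ P+S+H≈Z+R ⟩
        Z + R        ≈⟨ +-congʳ Z≈P+Z′ ⟩
        (P + Z′) + R ≈⟨ +-assoc P Z′ R ⟩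
        P + (Z′ + R) ∎))
    where
    open SetoidReasoning ≈-setoid
    S = ∑ Ps
    H = ∑ Hs
    R = ∑ Rest

  exchange-∣A : ∀ {P C Hs Rest Rest′} → FactorisesUniquely Hs → All IsAtom Hs → All IsAtom Rest′ →
    C ≈ P → Rest ↭≈ C ∷ Rest′ → A ≈ P → A + ∑ Hs ≈ B + ∑ Rest → A ∷ Hs ↭≈ B ∷ Rest
  exchange-∣A {C = C} {Hs} {Rest} {Rest′} unique aHs aRest′ C≈P Rest↭ A≈P A+H≈B+R = A∷Hs↭B∷Rest
    where
    H = ∑ Hs
    R′ = ∑ Rest′
    H≈B+R′ : H ≈ B + R′
    H≈B+R′ = +-cancelˡ A (atoms-lde aHs) (lde-+ B R′ dB (atoms-lde aRest′)) dA (begin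
      A + H        ≈⟨ A+H≈B+R ⟩
      B + ∑ Rest   ≈⟨ +-congˡ (∑-↭ Rest↭) ⟩
      B + (C + R′) ≈⟨ solve 3 (λ b c r → b ⊕ (c ⊕ r) ⊜ c ⊕ (b ⊕ r)) ≈-refl B C R′ ⟩
      C + (B + R′) ≈⟨ +-congʳ (≈-trans C≈P (≈-sym A≈P)) ⟩
      A + (B + R′) ∎)
      where open SetoidReasoning ≈-setoid
    A∷Hs↭B∷Rest : A ∷ Hs ↭≈ B ∷ Rest
    A∷Hs↭B∷Rest = begin
      A ∷ Hs        ↭⟨ ↭≈.↭-prep A (unique (B ∷ Rest′) (aB ∷ aRest′) H≈B+R′) ⟩
      A ∷ B ∷ Rest′ ↭⟨ ↭≈.↭-swap A B ↭≈.↭-refl ⟩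
      B ∷ A ∷ Rest′ ↭⟨ ↭≈.↭-prep B (↭≈.prep (≈-trans A≈P (≈-sym C≈P)) ↭≈.↭-refl) ⟩
      B ∷ C ∷ Rest′ ↭⟨ ↭≈.↭-prep B Rest↭ ⟨
      B ∷ Rest      ∎
      where open ↭≈.PermutationReasoning

  exchange-∣H : ∀ {P Ps C D Hs Hs′ Rest Rest′ Z} → IsPrime P → Exchange (P ∷ Ps) Hs′ →
    All IsPrime (P ∷ Ps) → FactorisesUniquely Hs → All IsAtom (D ∷ Hs′) → D ≈ P → Hs ↭≈ D ∷ Hs′ →
    All IsAtom Rest′ → C ≈ P → Rest ↭≈ C ∷ Rest′ → IsLeftDeadEnd Z →
    A + ∑ Hs ≈ B + ∑ Rest → ∑ (P ∷ Ps) + ∑ Hs ≈ Z + ∑ Rest → A ∷ Hs ↭≈ B ∷ Rest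
  exchange-∣H {P} {Ps} {C} {D} {Hs} {Hs′} {Rest} {Rest′} {Z} (dP , _) IH pPs unique (aD ∷ aHs′) D≈P Hs↭
              aRest′ C≈P Rest↭ dZ A+H≈B+R S+H≈Z+R = A∷Hs↭B∷Rest
    where
    S = ∑ (P ∷ Ps)
    H′ = ∑ Hs′
    R′ = ∑ Rest′
    dH′ = atoms-lde aHs′
    dR′ = atoms-lde aRest′
    H≈P+H′ : ∑ Hs ≈ P + H′
    H≈P+H′ = ≈-trans (∑-↭ Hs↭) (+-congʳ D≈P)
    R≈P+R′ : ∑ Rest ≈ P + R′
    R≈P+R′ = ≈-trans (∑-↭ Rest↭) (+-congʳ C≈P)
    swap-P : ∀ X Y → X + (P + Y) ≈ P + (X + Y)
    swap-P X Y = solve 3 (λ x p y → x ⊕ (p ⊕ y) ⊜ p ⊕ (x ⊕ y)) ≈-refl X P Y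
    A+H′≈B+R′ : A + H′ ≈ B + R′
    A+H′≈B+R′ = +-cancelˡ P (lde-+ A H′ dA dH′) (lde-+ B R′ dB dR′) dP (begin
      P + (A + H′) ≈⟨ swap-P A H′ ⟨
      A + (P + H′) ≈⟨ +-congˡ H≈P+H′ ⟨
      A + ∑ Hs     ≈⟨ A+H≈B+R ⟩
      B + ∑ Rest   ≈⟨ +-congˡ R≈P+R′ ⟩
      B + (P + R′) ≈⟨ swap-P B R′ ⟩
      P + (B + R′) ∎)
      where open SetoidReasoning ≈-setoid
    S+H′≈Z+R′ : S + H′ ≈ Z + R′
    S+H′≈Z+R′ = +-cancelˡ P (lde-+ S H′ (lde-∑ (All.map proj₁ pPs)) dH′) (lde-+ Z R′ dZ dR′) dP (begin
      P + (S + H′) ≈⟨ swap-P S H′ ⟨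
      S + (P + H′) ≈⟨ +-congˡ H≈P+H′ ⟨
      S + ∑ Hs     ≈⟨ S+H≈Z+R ⟩
      Z + ∑ Rest   ≈⟨ +-congˡ R≈P+R′ ⟩
      Z + (P + R′) ≈⟨ swap-P Z R′ ⟩
      P + (Z + R′) ∎)
      where open SetoidReasoning ≈-setoid
    A∷Hs↭B∷Rest : A ∷ Hs ↭≈ B ∷ Rest
    A∷Hs↭B∷Rest = begin
      A ∷ Hs        ↭⟨ ↭≈.↭-prep A Hs↭ ⟩
      A ∷ D ∷ Hs′   ↭⟨ ↭≈.↭-swap A D ↭≈.↭-refl ⟩
      D ∷ A ∷ Hs′   ↭⟨ ↭≈.↭-prep D (IH pPs (factorisesUniquely-drop unique Hs↭ aD) aHs′ aRest′ dZ
                                        A+H′≈B+R′ S+H′≈Z+R′) ⟩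
      D ∷ B ∷ Rest′ ↭⟨ ↭≈.↭-swap D B ↭≈.↭-refl ⟩
      B ∷ D ∷ Rest′ ↭⟨ ↭≈.↭-prep B (↭≈.prep (≈-trans D≈P (≈-sym C≈P)) ↭≈.↭-refl) ⟩
      B ∷ C ∷ Rest′ ↭⟨ ↭≈.↭-prep B Rest↭ ⟨
      B ∷ Rest      ∎
      where open ↭≈.PermutationReasoning

  exchange-∣R : ∀ {P Ps C Hs Rest Rest′ Z} → IsPrime P → (∀ {Hs′} → length Hs′ < length Hs → Exchange (P ∷ Ps) Hs′) →
    All IsPrime (P ∷ Ps) → FactorisesUniquely Hs → All IsAtom Hs → All IsAtom Rest′ → C ≈ P → Rest ↭≈ C ∷ Rest′ →
    IsLeftDeadEnd Z → A + ∑ Hs ≈ B + ∑ Rest → ∑ (P ∷ Ps) + ∑ Hs ≈ Z + ∑ Rest → A ∷ Hs ↭≈ B ∷ Rest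
  exchange-∣R {P = P} {Hs = Hs} {Rest′ = Rest′} pP@(_ , _ , prime) IH pPs unique aHs aRest′ C≈P Rest↭ dZ
              A+H≈B+R S+H≈Z+R =
    [ (λ P∣A → exchange-∣A unique aHs aRest′ C≈P Rest↭ (prime∣atom⇒≈ pP aA P∣A) A+H≈B+R)
    , (λ P∣H → let D , Hs′ , aDHs′ , D≈P , Hs↭ = prime∣∑atoms Hs pP aHs P∣H in
         exchange-∣H pP (IH (≤-reflexive (sym (xs↭ys⇒|xs|≡|ys| Hs↭)))) pPs unique aDHs′ D≈P Hs↭
                     aRest′ C≈P Rest↭ dZ A+H≈B+R S+H≈Z+R)
    ]′ (prime A (∑ Hs) dA (atoms-lde aHs) (∣-intro (B + ∑ Rest′) (lde-+ _ _ dB (atoms-lde aRest′)) A+H≈P+B+R′))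
    where
    A+H≈P+B+R′ : A + ∑ Hs ≈ P + (B + ∑ Rest′)
    A+H≈P+B+R′ = ≈-trans A+H≈B+R (≈-trans (+-congˡ (≈-trans (∑-↭ Rest↭) (+-congʳ C≈P)))
      (solve 3 (λ b p r → b ⊕ (p ⊕ r) ⊜ p ⊕ (b ⊕ r)) ≈-refl B P (∑ Rest′)))

  exchange-∷ : ∀ P Ps Hs → (∀ Hs → Exchange Ps Hs) → (∀ {Hs′} → length Hs′ < length Hs → Exchange (P ∷ Ps) Hs′) →
               Exchange (P ∷ Ps) Hs
  exchange-∷ P Ps Hs IHₚ IHₕ {Rest} {Z} pPs@(pP@(_ , _ , prime) ∷ pPs′) unique aHs aRest dZ A+H≈B+R S+H≈Z+R
    with prime Z (∑ Rest) dZ (atoms-lde aRest) (∣-intro (∑ Ps + ∑ Hs) dS+H Z+R≈P+S+H)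
    where
    dS+H : IsLeftDeadEnd (∑ Ps + ∑ Hs)
    dS+H = lde-+ _ _ (lde-∑ (All.map proj₁ pPs′)) (atoms-lde aHs)
    Z+R≈P+S+H : Z + ∑ Rest ≈ P + (∑ Ps + ∑ Hs)
    Z+R≈P+S+H = ≈-trans (≈-sym S+H≈Z+R) (+-assoc P (∑ Ps) (∑ Hs))
  ... | inj₁ (Z′ , dZ′ , Z≡P+Z′) = exchange-∣Z pP (IHₚ Hs) pPs′ unique aHs aRest dZ′ A+H≈B+R S+H≈Z+R (fromEq Z≡P+Z′)
  ... | inj₂ P∣R with prime∣∑atoms Rest pP aRest P∣R
  ...   | C , Rest′ , _ ∷ aRest′ , C≈P , Rest↭ =
    exchange-∣R pP IHₕ pPs unique aHs aRest′ C≈P Rest↭ dZ A+H≈B+R S+H≈Z+R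

  exchange : ∀ Ps Hs → Exchange Ps Hs
  exchange []       = exchange-[]
  exchange (P ∷ Ps) = wfRec (λ Hs → Exchange (P ∷ Ps) Hs) (λ Hs IH → exchange-∷ P Ps Hs (exchange Ps) IH)
    where open WF.All (On.wellFounded length <-wellFounded) 0ℓ

factorisesUniquely : ∀ Gs → All IsAtom Gs → AllSuffixes Gs → FactorisesUniquely Gs
factorisesUniquely []       _          _ = []-factorisesUniquely
factorisesUniquely (G ∷ Gs) (aG ∷ aGs) ((G′ , _ , (Ps , (_ , G′≡Ps) , pPs) , good) , suffixes) Cs aCs ∑≈∑Cs
  with goodOption⇒≈rightOption (sumG (G ∷ Gs)) (∑ Cs) (sumG (G′ ∷ Gs))
         (lde-sumG (All.map proj₁ (aG ∷ aGs))) (atoms-lde aCs) (≈-trans (sumG≈∑ (G ∷ Gs)) ∑≈∑Cs) good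
... | j , G′+Gs≈Cⱼ with rightOption-∑ Cs j
...   | B , Rest , Cs↭ , k , Cⱼ≈Bₖ+R with ↭.All-resp-↭ Cs↭ aCs
...     | aB ∷ aRest =
  ↭≈.↭-trans (exchange aG aB Ps Gs pPs (factorisesUniquely Gs aGs suffixes) aGs aRest (lde-right B (proj₁ aB) k)
               (≈-trans ∑≈∑Cs (∑-↭ (↭⇒↭≈ Cs↭))) Ps+Gs≈Bₖ+R)
             (↭≈.↭-sym (↭⇒↭≈ Cs↭))
  where
  Ps+Gs≈Bₖ+R : ∑ Ps + ∑ Gs ≈ opt Right B k + ∑ Rest
  Ps+Gs≈Bₖ+R = begin
    ∑ Ps + ∑ Gs            ≈⟨ +-congʳ (≈-trans (≈-sym (sumG≈∑ Ps)) (≈-sym (fromEq G′≡Ps))) ⟩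
    G′ + ∑ Gs              ≈⟨ sumG≈∑ (G′ ∷ Gs) ⟨
    sumG (G′ ∷ Gs)         ≈⟨ G′+Gs≈Cⱼ ⟩
    opt Right (∑ Cs) j     ≈⟨ Cⱼ≈Bₖ+R ⟩
    opt Right B k + ∑ Rest ∎
    where open SetoidReasoning ≈-setoid

mainTheorem17 : (G : Game) → IsLeftDeadEnd G → (Gs : List Game)
    → IsFactorisation G Gs → AllSuffixes Gs → IsUniquelyFactorisable G
mainTheorem17 G _ Gs (aGs , G≡Gs) suffixes = (Gs , aGs , G≡Gs) , λ As Bs (aAs , G≡As) (aBs , G≡Bs) →
  ↭≈⇒SameFactorisation (↭≈.↭-trans (↭≈.↭-sym (Gs↭ As aAs G≡As)) (Gs↭ Bs aBs G≡Bs))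
  where
  -- Only sums of atoms are compared, so G need not be known to be a Left dead end.
  Gs↭ : ∀ Hs → All IsAtom Hs → G ≡g sumG Hs → Gs ↭≈ Hs
  Gs↭ Hs aHs G≡Hs = factorisesUniquely Gs aGs suffixes Hs aHs
    (≈-trans (≈-sym (sumG≈∑ Gs)) (≈-trans (≈-sym (fromEq {G} G≡Gs)) (≈-trans (fromEq {G} G≡Hs) (sumG≈∑ Hs))))
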